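{- Let $\varphi=\langle X,Q,D,C\rangle$ be a QCSP and let $t\in\prod_{x\in X}D_x$. Let $B$ be the conjunction of constraints $\bigwedge_{x_i\in E}\Big(\big(\bigwedge_{y\in A_{i-1}}y=t_y\big)\rightarrow(x_i=t_{x_i})\Big)$. Then the QCSP $\psi=\langle X,Q,D,B\cup C\rangle$ is true iff $t\in\mathsf{out}^\varphi$.
   Context: Fix a finite set $\mathbb{D}$. For a finite set $V$ of variables, a $V$-tuple is a map $t:V\to\mathbb{D}$ (value at $x$ written $t_x$), and a $V$-relation is a set of $V$-tuples. A QCSP is a tuple $\varphi=\langle X,Q,D,C\rangle$ where $X=\{x_1,\dots,x_n\}$ is a finite set of variables linearly ordered by index, $Q$ assigns to each $x_i$ a quantifier $Q_{x_i}\in\{\forall,\exists\}$, $D$ assigns to each $x_i$ a domain $D_{x_i}\subseteq\mathbb{D}$, and $C$ is a finite set of constraints, each a $V$-relation for some $V\subseteq X$ (the conjunction $B$ above is viewed as a set of such relations on $X$, one per $x_i\in E$). For a $V$-tuple $t$ and $U\subseteq V$, $t|_U$ is its restriction. An $X$-tuple satisfies $C$ if $t|_V\in c$ for every $V$-relation $c\in C$; $\mathsf{sol}^\varphi$ is the set of such tuples. $\prod_{y\in V}D_y$ is the set of $V$-tuples $t$ with $t_y\in D_y$ for all $y$. Let $E=\{x_i:Q_{x_i}=\exists\}$, $A=\{x_i:Q_{x_i}=\forall\}$, $A_j=\{x_i\in A:i\le j\}$. A strategy is a family $s=(s_{x_i})_{x_i\in E}$ of functions $s_{x_i}:\prod_{y\in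 A_{i-1}}D_y\to D_{x_i}$; its scenarios $\mathsf{sce}^\varphi(s)$ are the $t\in\prod_{x\in X}D_x$ with $t_{x_i}=s_{x_i}(t|_{A_{i-1}})$ for all $x_i\in E$; $s$ is winning if $\mathsf{sce}^\varphi(s)\subseteq\mathsf{sol}^\varphi$; the outcomes are $\mathsf{out}^\varphi=\bigcup_{s\text{ winning}}\mathsf{sce}^\varphi(s)$. A QCSP is true if the sentence $Q_{x_1}x_1\in D_{x_1}\cdots Q_{x_n}x_n\in D_{x_n}.\ \bigwedge_{c\in C}c(\vec y_c)$ holds over $\mathbb{D}$ (bounded quantifiers, constraint symbols interpreted by their relations); equivalently iff it has a winning strategy. -}

module Defs where

open import Level using (0ℓ)
open import Data.Nat using (ℕ; suc; _<_; _<?_)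
open import Data.Fin using (Fin; toℕ)
open import Data.Fin.Subset using (Subset; _∈_)
open import Data.List as L using (List; []; _∷_; length; filter; allFin; map; _++_)
open import Data.Unit using (⊤)
open import Data.Vec using (Vec; []; _∷_; tabulate; lookup)
open import Data.Product using (Σ; _×_; _,_)
open import Relation.Binary.PropositionalEquality using (_≡_; refl)
open import Relation.Nullary using (Dec; yes; no)
open import Relation.Nullary.Decidable using (_×-dec_)
open import Relation.Unary using (Pred)

-- The fixed finite set 𝔻 is modelled as Fin d.
-- Variables x_1..x_n are modelled as Fin n (0-based, ordered by index).

data Quant : Set where
  ∀q ∃q : Quant

_≟Q_ : (p q : Quant) → Dec (p ≡ q)
∀q ≟Q ∀q = yes refl
∀q ≟Q ∃q = no λ ()
∃q ≟Q ∀q = no λ ()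
∃q ≟Q ∃q = yes refl

Tuple : ℕ → ℕ → Set
Tuple d n = Fin n → Fin d

restrict : ∀ {d n} (V : List (Fin n)) → Tuple d n → Vec (Fin d) (length V)
restrict V t = tabulate (λ k → t (L.lookup V k))

-- A constraint: a V-relation; V ⊆ X is given by a list of variables
-- (its scope) and the relation is a set of V-tuples.
record Constraint (d n : ℕ) : Set₁ where
  constructor mkC
  field
    scope : List (Fin n)
    rel   : Pred (Vec (Fin d) (length scope)) 0ℓ
open Constraint public

record QCSP (d n : ℕ) : Set₁ where
  constructor ⟨_,_,_⟩
  field
    Q   : Fin n → Quant
    Dom : Fin n → Subset d
    C   : List (Constraint d n)
open QCSP public

Sat : ∀ {d n} → List (Constraint d n) → Tuple d n → Set
Sat [] t = ⊤
Sat (c ∷ C) t = rel c (restrict (scope c) t) × Sat C t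

InProd : ∀ {d n} → (Fin n → Subset d) → Tuple d n → Set
InProd D t = ∀ x → t x ∈ D x

-- A_{i-1} = universal variables with index < i (listed in increasing order)
Abefore : ∀ {n} → (Fin n → Quant) → Fin n → List (Fin n)
Abefore {n} Q i = filter (λ y → (Q y ≟Q ∀q) ×-dec (toℕ y <? toℕ i)) (allFin n)

Evars : ∀ {n} → (Fin n → Quant) → List (Fin n)
Evars {n} Q = filter (λ y → Q y ≟Q ∃q) (allFin n)

-- Represented as a function on all A_{i-1}-tuples which maps tuples of
-- ∏_{y∈A_{i-1}} D_y into D_{x_i} (its values elsewhere are irrelevant).
record Strategy {d n : ℕ} (φ : QCSP d n) : Set where
  field
    fun  : (i : Fin n) → Q φ i ≡ ∃q → Vec (Fin d) (length (Abefore (Q φ) i)) → Fin d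
    into : (i : Fin n) (e : Q φ i ≡ ∃q) (w : Vec (Fin d) (length (Abefore (Q φ) i))) →
           (∀ k → lookup w k ∈ Dom φ (L.lookup (Abefore (Q φ) i) k)) →
           fun i e w ∈ Dom φ i
open Strategy public

Scenario : ∀ {d n} (φ : QCSP d n) → Strategy φ → Tuple d n → Set
Scenario φ s t = InProd (Dom φ) t ×
  ((i : _) (e : Q φ i ≡ ∃q) → t i ≡ fun s i e (restrict (Abefore (Q φ) i) t))

Winning : ∀ {d n} (φ : QCSP d n) → Strategy φ → Set
Winning φ s = ∀ t → Scenario φ s t → Sat (C φ) t

InOut : ∀ {d n} (φ : QCSP d n) → Tuple d n → Set
InOut φ t = Σ (Strategy φ) λ s → Winning φ s × Scenario φ s t

Sem : ∀ {d k} → Vec (Quant × Subset d) k → (Vec (Fin d) k → Set) → Set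
Sem [] M = M []
Sem {d} ((∀q , S) ∷ qs) M = (v : Fin d) → v ∈ S → Sem qs (λ w → M (v ∷ w))
Sem {d} ((∃q , S) ∷ qs) M = Σ (Fin d) λ v → v ∈ S × Sem qs (λ w → M (v ∷ w))

IsTrue : ∀ {d n} → QCSP d n → Set
IsTrue φ = Sem (tabulate (λ i → Q φ i , Dom φ i)) (λ w → Sat (C φ) (lookup w))

Bcon : ∀ {d n} → (Fin n → Quant) → Tuple d n → Fin n → Constraint d n
Bcon Q t i = mkC (i ∷ Abefore Q i) R
  where
    R : Pred (Vec _ (suc (length (Abefore Q i)))) 0ℓ
    R (v ∷ w) = (∀ k → lookup w k ≡ t (L.lookup (Abefore Q i) k)) → v ≡ t i

Bcons : ∀ {d n} → (Fin n → Quant) → Tuple d n → List (Constraint d n)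
Bcons Q t = map (Bcon Q t) (Evars Q)

withB : ∀ {d n} → QCSP d n → Tuple d n → QCSP d n
withB φ t = ⟨ Q φ , Dom φ , Bcons (Q φ) t ++ C φ ⟩

-- The proof goes through a game reading of quantified sentences.  A positional
-- strategy for a prefix Q₁x₁∈D₁ ⋯ Qₙxₙ∈Dₙ picks each existential value as a
-- function of the whole play that only looks at the earlier universal values
-- (uniformity).  Then a winning strategy with scenario t also wins
-- ψ; conversely a strategy winning ψ wins φ, and its play against the
-- universal values of t is, by B, t itself.
module Submission where

open import Defs
open import Axiom.UniquenessOfIdentityProofs using (module Decidable⇒UIP)
open import Data.Empty using (⊥; ⊥-elim)
open import Data.Fin using (Fin; toℕ; zero; suc; _≟_)
open import Data.Fin.Subset using (Subset; _∈_)
open import Data.Fin.Subset.Properties using (_∈?_)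
open import Data.List as L using (List; []; _∷_; length; allFin; map; _++_)
open import Data.List.Membership.Propositional using () renaming (_∈_ to _∈L_)
open import Data.List.Membership.Propositional.Properties using (∈-filter⁺; ∈-filter⁻; ∈-lookup; ∈-allFin)
open import Data.List.Relation.Unary.Any using (here; there; index)
open import Data.List.Relation.Unary.Any.Properties using (lookup-index)
open import Data.Nat using (ℕ; zero; suc; _<_; _<?_; s≤s; z≤n)
open import Data.Product using (Σ; _×_; _,_; proj₁; proj₂)
open import Data.Unit using (tt)
open import Data.Vec using (Vec; []; _∷_; tabulate; lookup)
open import Data.Vec.Properties using (lookup∘tabulate; tabulate-cong)
open import Function using (_∘_)
open import Function.Bundles using (_⇔_; mk⇔; Equivalence)
open import Relation.Binary.PropositionalEquality using (_≡_; refl; sym; trans; cong; subst; module ≡-Reasoning)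
open import Relation.Nullary using (yes; no)
open import Relation.Nullary.Decidable using (_×-dec_)

open Decidable⇒UIP _≟Q_ using (≡-irrelevant)

∀≢∃ : ∀ {q} → q ≡ ∀q → q ≡ ∃q → ⊥
∀≢∃ refl ()

module PrefixGame {d : ℕ} where

  prefix : ∀ {n} → (Fin n → Quant) → (Fin n → Subset d) → Vec (Quant × Subset d) n
  prefix Q D = tabulate (λ i → Q i , D i)

  InBox : ∀ {n} → (Fin n → Subset d) → Vec (Fin d) n → Set
  InBox D u = ∀ i → lookup u i ∈ D i

  Positional : ∀ {n} → (Fin n → Quant) → Set
  Positional {n} Q = (i : Fin n) → Q i ≡ ∃q → Vec (Fin d) n → Fin d

  AgreeBefore : ∀ {n} → (Fin n → Quant) → Fin n → Vec (Fin d) n → Vec (Fin d) n → Set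
  AgreeBefore Q i u u' = ∀ y → Q y ≡ ∀q → toℕ y < toℕ i → lookup u y ≡ lookup u' y

  Uniform : ∀ {n} (Q : Fin n → Quant) → Positional Q → Set
  Uniform Q σ = ∀ i e u u' → AgreeBefore Q i u u' → σ i e u ≡ σ i e u'

  IntoBox : ∀ {n} (Q : Fin n → Quant) (D : Fin n → Subset d) → Positional Q → Set
  IntoBox Q D σ = ∀ i e u → InBox D u → σ i e u ∈ D i

  Follows : ∀ {n} (Q : Fin n → Quant) → Positional Q → Vec (Fin d) n → Set
  Follows Q σ u = ∀ i e → lookup u i ≡ σ i e u

  record WinningPlay {n} (Q : Fin n → Quant) (D : Fin n → Subset d)
                     (M : Vec (Fin d) n → Set) : Set where
    field
      σ       : Positional Q
      uniform : Uniform Q σ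
      intoBox : IntoBox Q D σ
      wins    : ∀ u → InBox D u → Follows Q σ u → M u
  open WinningPlay

  inBox-∷ : ∀ {n} {D : Fin (suc n) → Subset d} {v w} →
    v ∈ D zero → InBox (D ∘ suc) w → InBox D (v ∷ w)
  inBox-∷ vD wD zero    = vD
  inBox-∷ vD wD (suc i) = wD i

  tail : ∀ {n} {Q : Fin (suc n) → Quant} → Positional Q → Fin d → Positional (Q ∘ suc)
  tail σ v j e w = σ (suc j) e (v ∷ w)

  uniform-tail : ∀ {n} {Q : Fin (suc n) → Quant} {σ : Positional Q} {v} →
    Uniform Q σ → Uniform (Q ∘ suc) (tail σ v)
  uniform-tail uni j e w w' agree = uni (suc j) e _ _ λ where
    zero    _  _         → refl
    (suc y) qy (s≤s y<j) → agree y qy y<j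

  intoBox-tail : ∀ {n} {Q : Fin (suc n) → Quant} {D} {σ : Positional Q} {v} →
    IntoBox Q D σ → v ∈ D zero → IntoBox (Q ∘ suc) (D ∘ suc) (tail σ v)
  intoBox-tail into vD j e w wD = into (suc j) e _ (inBox-∷ vD wD)

  -- The first move depends on nothing: no universal precedes position zero.
  firstMove-const : ∀ {n} {Q : Fin (suc n) → Quant} {σ : Positional Q} →
    Uniform Q σ → ∀ e e' u u' → σ zero e u ≡ σ zero e' u'
  firstMove-const uni e e' u u' with ≡-irrelevant e e'
  ... | refl = uni zero e u u' λ _ _ ()

  descend : ∀ {n} {Q : Fin (suc n) → Quant} {D M} (W : WinningPlay Q D M) (v : Fin d) →
    v ∈ D zero → (∀ e u → v ≡ σ W zero e u) →
    WinningPlay (Q ∘ suc) (D ∘ suc) (λ w → M (v ∷ w))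
  descend W v vD legal = record
    { σ       = tail (σ W) v
    ; uniform = uniform-tail (uniform W)
    ; intoBox = intoBox-tail (intoBox W) vD
    ; wins    = λ w wD follows → wins W (v ∷ w) (inBox-∷ vD wD) λ where
        zero    e → legal e (v ∷ w)
        (suc j) e → follows j e
    }

  -- A winning strategy makes the quantified sentence true (given that the box
  -- is inhabited, so that first moves can be evaluated).
  strategy⇒sem : ∀ {n} {Q : Fin n → Quant} {D M} (u₀ : Vec (Fin d) n) → InBox D u₀ →
    WinningPlay Q D M → Sem (prefix Q D) M
  strategy⇒sem {zero} [] _ W = wins W [] (λ ()) (λ ())
  strategy⇒sem {suc n} {Q} {D} (x ∷ u₀) u₀D W with Q zero in eq
  ... | ∀q = λ v vD → strategy⇒sem u₀ (u₀D ∘ suc)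
                        (descend W v vD λ e _ → ⊥-elim (∀≢∃ eq e))
  ... | ∃q = v , vD , strategy⇒sem u₀ (u₀D ∘ suc)
                        (descend W v vD λ e u → firstMove-const (uniform W) eq e _ u)
    where
    v : Fin d
    v  = σ W zero eq (x ∷ u₀)
    vD : v ∈ D zero
    vD = intoBox W zero eq (x ∷ u₀) u₀D

  legalise : ∀ {n} (D : Fin (suc n) → Subset d) (x : Fin d) → x ∈ D zero → (v : Fin d) →
    Σ (Fin d) λ v' → v' ∈ D zero × (v ∈ D zero → v' ≡ v)
  legalise D x xD v with v ∈? D zero
  ... | yes vD = v , vD , λ _ → refl
  ... | no  v∉ = x , xD , λ vD → ⊥-elim (v∉ vD)

  -- Truth of the sentence yields a winning strategy (the Skolem functions of
  -- the sentence, made total on the box).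
  sem⇒strategy : ∀ {n} {Q : Fin n → Quant} {D M} (u₀ : Vec (Fin d) n) → InBox D u₀ →
    Sem (prefix Q D) M → WinningPlay Q D M
  sem⇒strategy {zero} [] _ sem = record
    { σ = λ () ; uniform = λ () ; intoBox = λ () ; wins = λ { [] _ _ → sem } }
  sem⇒strategy {suc n} {Q} {D} {M} (x ∷ u₀) u₀D sem with Q zero in eq
  ... | ∀q = record { σ = σ′ ; uniform = uniform′ ; intoBox = intoBox′ ; wins = wins′ }
    where
    legal : (v : Fin d) → Σ (Fin d) λ v' → v' ∈ D zero × (v ∈ D zero → v' ≡ v)
    legal = legalise D x (u₀D zero)
    branch : (v : Fin d) → WinningPlay (Q ∘ suc) (D ∘ suc) (λ w → M (proj₁ (legal v) ∷ w))
    branch v = sem⇒strategy u₀ (u₀D ∘ suc) (sem (proj₁ (legal v)) (proj₁ (proj₂ (legal v))))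
    σ′ : Positional Q
    σ′ zero    e _       = ⊥-elim (∀≢∃ eq e)
    σ′ (suc j) e (v ∷ w) = σ (branch v) j e w
    uniform′ : Uniform Q σ′
    uniform′ zero e _ _ _ = ⊥-elim (∀≢∃ eq e)
    uniform′ (suc j) e (v ∷ w) (v' ∷ w') agree with agree zero eq (s≤s z≤n)
    ... | refl = uniform (branch v) j e w w' λ y qy y<j → agree (suc y) qy (s≤s y<j)
    intoBox′ : IntoBox Q D σ′
    intoBox′ zero    e _       _  = ⊥-elim (∀≢∃ eq e)
    intoBox′ (suc j) e (v ∷ w) uD = intoBox (branch v) j e w (uD ∘ suc)
    wins′ : ∀ u → InBox D u → Follows Q σ′ u → M u
    wins′ (v ∷ w) uD follows = subst (λ z → M (z ∷ w)) (proj₂ (proj₂ (legal v)) (uD zero))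
      (wins (branch v) w (uD ∘ suc) (follows ∘ suc))
  ... | ∃q with sem
  ...   | v , vD , rest = record { σ = σ′ ; uniform = uniform′ ; intoBox = intoBox′ ; wins = wins′ }
    where
    W : WinningPlay (Q ∘ suc) (D ∘ suc) (λ w → M (v ∷ w))
    W = sem⇒strategy u₀ (u₀D ∘ suc) rest
    σ′ : Positional Q
    σ′ zero    _ _       = v
    σ′ (suc j) e (_ ∷ w) = σ W j e w
    uniform′ : Uniform Q σ′
    uniform′ zero    _ _       _        _     = refl
    uniform′ (suc j) e (_ ∷ w) (_ ∷ w') agree =
      uniform W j e w w' λ y qy y<j → agree (suc y) qy (s≤s y<j)
    intoBox′ : IntoBox Q D σ′
    intoBox′ zero    _ _       _  = vD
    intoBox′ (suc j) e (_ ∷ w) uD = intoBox W j e w (uD ∘ suc)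
    wins′ : ∀ u → InBox D u → Follows Q σ′ u → M u
    wins′ (x' ∷ w) uD follows with follows zero eq
    ... | refl = wins W w (uD ∘ suc) (follows ∘ suc)

  AgreeOnUniversals : ∀ {n} → (Fin n → Quant) → Vec (Fin d) n → Vec (Fin d) n → Set
  AgreeOnUniversals Q u v = ∀ y → Q y ≡ ∀q → lookup u y ≡ lookup v y

  play : ∀ {n} {Q : Fin n → Quant} {D} (σ : Positional Q) → Uniform Q σ → IntoBox Q D σ →
    ∀ v → InBox D v → Σ (Vec (Fin d) n) λ u → InBox D u × Follows Q σ u × AgreeOnUniversals Q u v
  play {zero} σ _ _ [] _ = [] , (λ ()) , (λ ()) , (λ ())
  play {suc n} {Q} {D} σ uni into (x ∷ v) vD = byFirst (Q zero) refl
    where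
    Result : Set
    Result = Σ (Vec (Fin d) (suc n)) λ u → InBox D u × Follows Q σ u × AgreeOnUniversals Q u (x ∷ v)
    extend : (a : Fin d) → a ∈ D zero → (∀ e u → a ≡ σ zero e (a ∷ u)) → (Q zero ≡ ∀q → a ≡ x) → Result
    extend a aD legal copies
      with play (tail σ a) (uniform-tail uni) (intoBox-tail into aD) v (vD ∘ suc)
    ... | u , uD , follows , agree =
          a ∷ u , inBox-∷ aD uD
        , (λ { zero e → legal e u ; (suc j) e → follows j e })
        , (λ { zero qy → copies qy ; (suc y) qy → agree y qy })
    byFirst : (q : Quant) → Q zero ≡ q → Result
    byFirst ∀q eq = extend x (vD zero) (λ e _ → ⊥-elim (∀≢∃ eq e)) (λ _ → refl)
    byFirst ∃q eq = extend (σ zero eq (x ∷ v)) (into zero eq (x ∷ v) vD)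
      (λ e u → firstMove-const uni eq e (x ∷ v) _) (λ q → ⊥-elim (∀≢∃ q eq))

module Constraints {d n : ℕ} where

  Holds : Constraint d n → Tuple d n → Set
  Holds c x = rel c (restrict (scope c) x)

  Sat-++ : ∀ (C₁ : List (Constraint d n)) {C₂ x} → Sat (C₁ ++ C₂) x ⇔ (Sat C₁ x × Sat C₂ x)
  Sat-++ C₁ {C₂} {x} = mk⇔ (split C₁) (λ (s₁ , s₂) → join C₁ s₁ s₂)
    where
    split : ∀ C₁ → Sat (C₁ ++ C₂) x → Sat C₁ x × Sat C₂ x
    split []       s        = tt , s
    split (c ∷ C₁) (h , s) with split C₁ s
    ... | s₁ , s₂ = (h , s₁) , s₂
    join : ∀ C₁ → Sat C₁ x → Sat C₂ x → Sat (C₁ ++ C₂) x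
    join []       _        s₂ = s₂
    join (c ∷ C₁) (h , s₁) s₂ = h , join C₁ s₁ s₂

  Sat-map : ∀ {A : Set} (f : A → Constraint d n) (as : List A) {x} →
    Sat (map f as) x ⇔ (∀ a → a ∈L as → Holds (f a) x)
  Sat-map f as {x} = mk⇔ (get as) (build as)
    where
    get : ∀ as → Sat (map f as) x → ∀ a → a ∈L as → Holds (f a) x
    get (a ∷ as) (h , _) a (here refl) = h
    get (_ ∷ as) (_ , s) a (there a∈)  = get as s a a∈
    build : ∀ as → (∀ a → a ∈L as → Holds (f a) x) → Sat (map f as) x
    build []       _ = tt
    build (a ∷ as) h = h a (here refl) , build as λ b b∈ → h b (there b∈)

  Sat-cong : ∀ (C : List (Constraint d n)) {x y : Tuple d n} → (∀ i → x i ≡ y i) → Sat C x → Sat C y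
  Sat-cong []       _   _       = tt
  Sat-cong (c ∷ C) x≗y (h , s) =
    subst (rel c) (tabulate-cong λ k → x≗y (L.lookup (scope c) k)) h , Sat-cong C x≗y s

module Quantifiers {n : ℕ} (Q : Fin n → Quant) where

  A : Fin n → List (Fin n)
  A = Abefore Q

  A-sound : ∀ i k → Q (L.lookup (A i) k) ≡ ∀q × toℕ (L.lookup (A i) k) < toℕ i
  A-sound i k = proj₂ (∈-filter⁻ (λ y → (Q y ≟Q ∀q) ×-dec (toℕ y <? toℕ i)) {xs = allFin n} (∈-lookup k))

  A-complete : ∀ i y → Q y ≡ ∀q → toℕ y < toℕ i → y ∈L A i
  A-complete i y qy y<i = ∈-filter⁺ (λ y → (Q y ≟Q ∀q) ×-dec (toℕ y <? toℕ i)) (∈-allFin y) (qy , y<i)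

  E-sound : ∀ {i} → i ∈L Evars Q → Q i ≡ ∃q
  E-sound i∈ = proj₂ (∈-filter⁻ (λ y → Q y ≟Q ∃q) {xs = allFin n} i∈)

  E-complete : ∀ {i} → Q i ≡ ∃q → i ∈L Evars Q
  E-complete {i} e = ∈-filter⁺ (λ y → Q y ≟Q ∃q) (∈-allFin i) e

module Outcomes {d n : ℕ} (φ : QCSP d n) (t : Tuple d n) (tD : InProd (Dom φ) t) where
  open PrefixGame {d}
  open Constraints {d} {n}
  open Quantifiers (Q φ)
  open Equivalence using (to; from)
  open import Data.List.Membership.DecPropositional (_≟_ {n}) using () renaming (_∈?_ to _∈L?_)

  D : Fin n → Subset d
  D = Dom φ

  AgreesOn : List (Fin n) → Tuple d n → Tuple d n → Set
  AgreesOn V x y = ∀ k → x (L.lookup V k) ≡ y (L.lookup V k)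

  Bcons-spec : ∀ x → Sat (Bcons (Q φ) t) x ⇔ (∀ i → Q φ i ≡ ∃q → AgreesOn (A i) x t → x i ≡ t i)
  Bcons-spec x = mk⇔
    (λ sat i e agree → to (Sat-map (Bcon (Q φ) t) (Evars (Q φ))) sat i (E-complete e)
                         λ k → trans (lookup∘tabulate _ k) (agree k))
    (λ copies → from (Sat-map (Bcon (Q φ) t) (Evars (Q φ))) λ i i∈ agree →
                  copies i (E-sound i∈) λ k → trans (sym (lookup∘tabulate _ k)) (agree k))

  fill : (V : List (Fin n)) → Vec (Fin d) (length V) → Tuple d n
  fill V w y with y ∈L? V
  ... | yes y∈ = lookup w (index y∈)
  ... | no  _  = t y

  fill-restrict : ∀ V x y → y ∈L V → fill V (restrict V x) y ≡ x y
  fill-restrict V x y y∈ with y ∈L? V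
  ... | yes y∈′ = trans (lookup∘tabulate _ (index y∈′)) (cong x (sym (lookup-index y∈′)))
  ... | no  y∉  = ⊥-elim (y∉ y∈)

  fill-inProd : ∀ V w → (∀ k → lookup w k ∈ D (L.lookup V k)) → InProd D (fill V w)
  fill-inProd V w wD y with y ∈L? V
  ... | yes y∈ = subst (λ z → lookup w (index y∈) ∈ D z) (sym (lookup-index y∈)) (wD (index y∈))
  ... | no  _  = tD y

  inBox : ∀ {x} → InProd D x → InBox D (tabulate x)
  inBox {x} xD i = subst (_∈ D i) (sym (lookup∘tabulate x i)) (xD i)

  positional : Strategy φ → Positional (Q φ)
  positional s i e u = fun s i e (restrict (A i) (lookup u))

  positional-uniform : ∀ s → Uniform (Q φ) (positional s)
  positional-uniform s i e u u' agree = cong (fun s i e) (tabulate-cong λ k →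
    agree _ (proj₁ (A-sound i k)) (proj₂ (A-sound i k)))

  positional-intoBox : ∀ s → IntoBox (Q φ) D (positional s)
  positional-intoBox s i e u uD = into s i e _ λ k →
    subst (_∈ D (L.lookup (A i) k)) (sym (lookup∘tabulate _ k)) (uD _)

  fromPositional : (σ : Positional (Q φ)) → IntoBox (Q φ) D σ → Strategy φ
  fun  (fromPositional σ _)  i e w    = σ i e (tabulate (fill (A i) w))
  into (fromPositional σ σD) i e w wD = σD i e _ (inBox (fill-inProd (A i) w wD))

  -- For a uniform σ the filled-in values are irrelevant.
  fromPositional-restrict : ∀ σ σD → Uniform (Q φ) σ → ∀ i e x →
    fun (fromPositional σ σD) i e (restrict (A i) x) ≡ σ i e (tabulate x)
  fromPositional-restrict σ σD uni i e x = uni i e _ _ λ y qy y<i → begin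
    lookup (tabulate (fill (A i) (restrict (A i) x))) y ≡⟨ lookup∘tabulate _ y ⟩
    fill (A i) (restrict (A i) x) y                     ≡⟨ fill-restrict (A i) x y (A-complete i y qy y<i) ⟩
    x y                                                 ≡⟨ sym (lookup∘tabulate x y) ⟩
    lookup (tabulate x) y                               ∎
    where open ≡-Reasoning

  -- A winning strategy with t among its scenarios also wins ψ: its scenarios
  -- satisfy C, and copy t wherever their universal history does.
  outcome⇒true : InOut φ t → IsTrue (withB φ t)
  outcome⇒true (s , winning , (_ , t-follows)) = strategy⇒sem (tabulate t) (inBox tD) record
    { σ       = positional s
    ; uniform = positional-uniform s
    ; intoBox = positional-intoBox s
    ; wins    = λ u uD follows → from (Sat-++ (Bcons (Q φ) t))
        (from (Bcons-spec (lookup u)) (copies u follows) , winning (lookup u) (uD , follows))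
    }
    where
    open ≡-Reasoning
    copies : ∀ u → Follows (Q φ) (positional s) u →
      ∀ i → Q φ i ≡ ∃q → AgreesOn (A i) (lookup u) t → lookup u i ≡ t i
    copies u follows i e agree = begin
      lookup u i                              ≡⟨ follows i e ⟩
      fun s i e (restrict (A i) (lookup u))   ≡⟨ cong (fun s i e) (tabulate-cong agree) ⟩
      fun s i e (restrict (A i) t)            ≡⟨ sym (t-follows i e) ⟩
      t i                                     ∎

  -- A winning strategy of ψ wins φ; playing it against the universal values
  -- of t yields a scenario which, by B, is t itself.
  true⇒outcome : IsTrue (withB φ t) → InOut φ t
  true⇒outcome sem = s , winning , (tD , t-follows)
    where
    open WinningPlay (sem⇒strategy (tabulate t) (inBox tD) sem)
    open ≡-Reasoning
    s : Strategy φ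
    s = fromPositional σ intoBox
    s-restrict : ∀ i e x → fun s i e (restrict (A i) x) ≡ σ i e (tabulate x)
    s-restrict = fromPositional-restrict σ intoBox uniform
    winning : Winning φ s
    winning x (xD , follows) = proj₂ (to (Sat-++ (Bcons (Q φ) t))
      (Sat-cong _ (lookup∘tabulate x) (wins (tabulate x) (inBox xD) λ i e →
        trans (lookup∘tabulate x i) (trans (follows i e) (s-restrict i e x)))))
    t-follows : ∀ i e → t i ≡ fun s i e (restrict (A i) t)
    t-follows i e with play σ uniform intoBox (tabulate t) (inBox tD)
    ... | u , uD , follows , agree = begin
      t i                          ≡⟨ sym (copies i e λ k → trans (agree _ (proj₁ (A-sound i k))) (lookup∘tabulate t _)) ⟩
      lookup u i                   ≡⟨ follows i e ⟩
      σ i e u                      ≡⟨ uniform i e u (tabulate t) (λ y qy _ → agree y qy) ⟩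
      σ i e (tabulate t)           ≡⟨ sym (s-restrict i e t) ⟩
      fun s i e (restrict (A i) t) ∎
      where
      copies : ∀ i → Q φ i ≡ ∃q → AgreesOn (A i) (lookup u) t → lookup u i ≡ t i
      copies = to (Bcons-spec (lookup u)) (proj₁ (to (Sat-++ (Bcons (Q φ) t)) (wins u uD follows)))

proposition10 : (d n : ℕ) (φ : QCSP d n) (t : Tuple d n) →
    InProd (Dom φ) t →
    (IsTrue (withB φ t) ⇔ InOut φ t)
proposition10 d n φ t tD = mk⇔ true⇒outcome outcome⇒true
  where open Outcomes φ t tD
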